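{- For every integer $n \geq 2$, the polynomial $N_n := \left(1 - \sum_{j=1}^n x_j\right)^2 \in \mathbb{R}[x_1,\ldots,x_n]$ is not a sum of nonnegative circuit polynomials (SONC).
   Context: For $f \in \mathbb{R}[\mathbf{x}]=\mathbb{R}[x_1,\dots,x_n]$, $\mathrm{New}(f)$ denotes the Newton polytope (convex hull of the exponent vectors of $f$). A lattice point is even if it lies in $(2\mathbb{N})^n$. A circuit polynomial is a polynomial of the form $f(\mathbf{x}) = f_{\boldsymbol\beta}\mathbf{x}^{\boldsymbol\beta} + \sum_{j=0}^r f_{\boldsymbol\alpha(j)}\mathbf{x}^{\boldsymbol\alpha(j)}$ with $r \le n$, coefficients $f_{\boldsymbol\alpha(j)} > 0$, $f_{\boldsymbol\beta} \in \mathbb{R}$, such that $\mathrm{New}(f)$ is a simplex with even vertices $\boldsymbol\alpha(0),\ldots,\boldsymbol\alpha(r)$ and $\boldsymbol\beta$ lies in the strict interior of $\mathrm{New}(f)$. The SONC cone is the set of all finite sums $\sum_i \mu_i p_i$ with $\mu_i \ge 0$ and each $p_i$ a circuit polynomial that is nonnegative on $\mathbb{R}^n$. -}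

module Defs where

open import Level using (0ℓ)
open import Data.Nat as ℕ using (ℕ; zero; suc)
open import Data.Nat.Divisibility using (_∣_)
open import Data.Fin using (Fin; zero; suc; _≟_)
open import Data.Vec using (Vec; lookup; tabulate; replicate; zipWith)
import Data.Vec.Properties as VecP
open import Data.List using (List; []; _∷_; _++_; map; concatMap; foldr)
import Data.List as List
open import Data.List.Relation.Unary.All using (All)
open import Data.Product using (Σ; ∃; _×_; _,_; proj₁; proj₂)
open import Relation.Nullary using (¬_; yes; no)
open import Relation.Binary using (Rel; IsTotalOrder)
open import Relation.Binary.PropositionalEquality using (_≡_)
open import Algebra.Structures using (IsCommutativeRing)

-- The real numbers, axiomatised as a Dedekind-complete ordered field
-- (unique up to isomorphism; classically this is ℝ).

record CompleteOrderedField : Set₁ where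
  infixl 7 _*_
  infixl 6 _+_
  infix  4 _≤_ _<_
  field
    Carrier : Set
    _+_ _*_ : Carrier → Carrier → Carrier
    -_      : Carrier → Carrier
    0# 1#   : Carrier
    isCommutativeRing : IsCommutativeRing _≡_ _+_ _*_ -_ 0# 1#
    0≢1     : ¬ (0# ≡ 1#)
    inverse : ∀ a → ¬ (a ≡ 0#) → Σ Carrier (λ b → a * b ≡ 1#)
    _≤_     : Rel Carrier 0ℓ
    isTotalOrder : IsTotalOrder _≡_ _≤_
    +-mono-≤   : ∀ {a b} c → a ≤ b → a + c ≤ b + c
    *-nonneg   : ∀ {a b} → 0# ≤ a → 0# ≤ b → 0# ≤ a * b
    complete : (S : Carrier → Set) → Σ Carrier S →
               Σ Carrier (λ u → ∀ x → S x → x ≤ u) →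
               Σ Carrier (λ s → (∀ x → S x → x ≤ s) ×
                                (∀ u → (∀ x → S x → x ≤ u) → s ≤ u))

  _<_ : Rel Carrier 0ℓ
  a < b = (a ≤ b) × ¬ (a ≡ b)

-- Polynomials in n variables over F, as finite lists of terms
-- (coefficient, exponent vector).  Two polynomials are equal iff all
-- their coefficients agree.

module _ (F : CompleteOrderedField) where
  open CompleteOrderedField F

  Term : ℕ → Set
  Term n = Carrier × Vec ℕ n

  Poly : ℕ → Set
  Poly n = List (Term n)

  ι : ℕ → Carrier
  ι zero    = 0#
  ι (suc k) = 1# + ι k

  _^_ : Carrier → ℕ → Carrier
  x ^ zero  = 1#
  x ^ suc k = x * (x ^ k)

  ∑ : ∀ {m} → (Fin m → Carrier) → Carrier
  ∑ {zero}  f = 0#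
  ∑ {suc m} f = f zero + ∑ (λ j → f (suc j))

  ∏ : ∀ {m} → (Fin m → Carrier) → Carrier
  ∏ {zero}  f = 1#
  ∏ {suc m} f = f zero * ∏ (λ j → f (suc j))

  monomial : ∀ {n} → Vec ℕ n → Vec Carrier n → Carrier
  monomial a x = ∏ (λ i → lookup x i ^ lookup a i)

  eval : ∀ {n} → Poly n → Vec Carrier n → Carrier
  eval p x = foldr (λ t acc → proj₁ t * monomial (proj₂ t) x + acc) 0# p

  coeff : ∀ {n} → Poly n → Vec ℕ n → Carrier
  coeff []            a = 0#
  coeff ((c , b) ∷ p) a with VecP.≡-dec ℕ._≟_ b a
  ... | yes _ = c + coeff p a
  ... | no  _ = coeff p a

  _≐_ : ∀ {n} → Poly n → Poly n → Set
  p ≐ q = ∀ a → coeff p a ≡ coeff q a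

  scale : ∀ {n} → Carrier → Poly n → Poly n
  scale μ = map (λ t → μ * proj₁ t , proj₂ t)

  _⊕_ : ∀ {n} → Poly n → Poly n → Poly n
  p ⊕ q = p ++ q

  _⊗_ : ∀ {n} → Poly n → Poly n → Poly n
  p ⊗ q = concatMap (λ s → map (λ t → proj₁ s * proj₁ t ,
                                      zipWith ℕ._+_ (proj₂ s) (proj₂ t)) q) p

  unitVec : ∀ {n} → Fin n → Vec ℕ n
  unitVec j = tabulate (λ i → isJ i)
    where isJ : _ → ℕ
          isJ i with i ≟ j
          ... | yes _ = 1
          ... | no  _ = 0

  N : (n : ℕ) → Poly n
  N n = L ⊗ L
    where L : Poly n
          L = (1# , replicate n 0) ∷ List.tabulate (λ j → (- 1#) , unitVec j)

  record Circuit (n : ℕ) : Set where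
    field
      r      : ℕ
      r≤n    : r ℕ.≤ n
      α      : Fin (suc r) → Vec ℕ n
      β      : Vec ℕ n
      fα     : Fin (suc r) → Carrier
      fβ     : Carrier
      fα>0   : ∀ j → 0# < fα j
      α-even : ∀ j i → 2 ∣ lookup (α j) i
      -- α(0),…,α(r) are affinely independent (so New(f) is an r-simplex)
      affInd : (w : Fin (suc r) → Carrier) →
               ∑ w ≡ 0# →
               (∀ i → ∑ (λ j → w j * ι (lookup (α j) i)) ≡ 0#) →
               ∀ j → w j ≡ 0#
      -- β lies in the (relative) interior of the simplex:
      -- strictly positive barycentric coordinates
      bary     : Fin (suc r) → Carrier
      bary>0   : ∀ j → 0# < bary j
      bary-sum : ∑ bary ≡ 1#
      bary-β   : ∀ i → ∑ (λ j → bary j * ι (lookup (α j) i)) ≡ ι (lookup β i)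

  circuitPoly : ∀ {n} → Circuit n → Poly n
  circuitPoly C = (fβ , β) ∷ List.tabulate (λ j → fα j , α j)
    where open Circuit C

  Nonneg : ∀ {n} → Poly n → Set
  Nonneg p = ∀ x → 0# ≤ eval p x

  sumPolys : ∀ {n} → List (Poly n) → Poly n
  sumPolys = foldr _⊕_ []

  SONC : ∀ {n} → Poly n → Set
  SONC {n} f =
    Σ (List (Carrier × Circuit n)) λ ps →
      All (λ t → (0# ≤ proj₁ t) × Nonneg (circuitPoly (proj₂ t))) ps
      × (f ≐ sumPolys (map (λ t → scale (proj₁ t) (circuitPoly (proj₂ t))) ps))

module Submission where

-- Let m ≥ 0, n = m + 2, and consider the three points
--   z = (0,0,0,…,0),   e₁ = (1,0,0,…,0),   e₂ = (0,1,0,…,0)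
-- of Fⁿ.  Every NONNEGATIVE circuit polynomial P satisfies the
-- "three-point inequality"  P(z) ≤ P(e₁) + P(e₂).  Indeed, a monomial
-- x^a satisfies z^a ≤ e₁^a and z^a ≤ e₂^a, and for each a one of the two
-- is an equality; choosing y ∈ {e₁, e₂} with z^β = y^β, the terms of P
-- with positive coefficients can only grow from z to y, while the
-- single remaining term x^β does not change, so P(z) ≤ P(y), and
-- P(y) ≤ P(e₁) + P(e₂) since P is nonnegative at the other point.
-- The inequality is preserved by nonnegative combinations, hence holds
-- for every SONC polynomial.  But N(z) = 1 and N(e₁) = N(e₂) = 0.

open import Defs
open import Data.Nat using (ℕ; _≤_; zero; suc; s≤s; z≤n)
open import Relation.Nullary using (¬_; yes; no; does; contradiction)

open import Level using (0ℓ)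
import Data.Nat as ℕ
import Data.Nat.Properties as ℕP
open import Data.Fin using (Fin; zero; suc; _≟_)
open import Data.Vec using (Vec; []; _∷_; lookup; replicate; zipWith)
import Data.Vec.Properties as VecP
open import Data.Vec.Relation.Unary.All as VecAll using ([]; _∷_)
open import Data.List using (List; []; _∷_; _++_; map; length)
import Data.List as List
open import Data.List.Relation.Unary.All using (All; []; _∷_)
open import Data.List.Relation.Unary.All.Properties using (tabulate⁺)
open import Data.Product using (_×_; _,_; proj₁; proj₂)
open import Data.Sum using (_⊎_; inj₁; inj₂)
open import Data.Bool using (if_then_else_)
open import Relation.Binary.PropositionalEquality
open import Relation.Binary using (IsTotalOrder)
open import Algebra.Bundles using (CommutativeRing)
open import Function using (_∋_)
import Algebra.Properties.Ring as RingProperties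
import Algebra.Properties.CommutativeSemigroup as CommSemigroupProperties

module _ (F : CompleteOrderedField) where
  open CompleteOrderedField F renaming (_≤_ to _⊑_)
  open IsTotalOrder isTotalOrder using (total; antisym)
    renaming (refl to ⊑-refl; trans to ⊑-trans)

  fieldRing : CommutativeRing 0ℓ 0ℓ
  fieldRing = record { isCommutativeRing = isCommutativeRing }

  open CommutativeRing fieldRing using
    (+-assoc; +-comm; +-identityˡ; +-identityʳ; -‿inverseʳ; *-assoc;
     *-identityˡ; *-identityʳ; distribˡ; distribʳ; zeroˡ; zeroʳ;
     +-commutativeSemigroup; *-commutativeSemigroup)
  open RingProperties (CommutativeRing.ring fieldRing) using (-1*x≈-x; -‿involutive; x∙y⁻¹≈ε⇒x≈y)
  open CommSemigroupProperties +-commutativeSemigroup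
    using () renaming (interchange to +-interchange)
  open CommSemigroupProperties *-commutativeSemigroup
    using () renaming (interchange to *-interchange)

  ev : ∀ {n} → Poly F n → Vec Carrier n → Carrier
  ev = eval F

  mon : ∀ {n} → Vec ℕ n → Vec Carrier n → Carrier
  mon = monomial F

  pow : Carrier → ℕ → Carrier
  pow = _^_ F

  ⊑-+ : ∀ {a b c d} → a ⊑ b → c ⊑ d → a + c ⊑ b + d
  ⊑-+ {a} {b} {c} {d} a⊑b c⊑d =
    ⊑-trans (+-mono-≤ c a⊑b)
      (subst₂ _⊑_ (+-comm c b) (+-comm d b) (+-mono-≤ b c⊑d))

  -- In a totally ordered field 1 is positive: if 1 ⊑ 0 then 0 ⊑ -1,
  -- and then 0 ⊑ (-1)(-1) = 1.
  0⊑1 : 0# ⊑ 1#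
  0⊑1 with total 0# 1#
  ... | inj₁ 0⊑1 = 0⊑1
  ... | inj₂ 1⊑0 = subst (0# ⊑_) square (*-nonneg 0⊑-1 0⊑-1)
    where
      0⊑-1 : 0# ⊑ - 1#
      0⊑-1 = subst₂ _⊑_ (-‿inverseʳ 1#) (+-identityˡ (- 1#)) (+-mono-≤ (- 1#) 1⊑0)
      square : (- 1#) * (- 1#) ≡ 1#
      square = trans (-1*x≈-x (- 1#)) (-‿involutive 1#)

  1⋢0 : ¬ (1# ⊑ 0#)
  1⋢0 1⊑0 = 0≢1 (antisym 0⊑1 1⊑0)

  ⊑-+ʳ : ∀ {a b} → 0# ⊑ b → a ⊑ a + b
  ⊑-+ʳ {a} {b} 0⊑b = subst (_⊑ a + b) (+-identityʳ a) (⊑-+ ⊑-refl 0⊑b)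

  ⊑-+ˡ : ∀ {a b} → 0# ⊑ a → b ⊑ a + b
  ⊑-+ˡ {a} {b} 0⊑a = subst (b ⊑_) (+-comm b a) (⊑-+ʳ 0⊑a)

  *-monoˡ : ∀ {a b c} → 0# ⊑ c → a ⊑ b → c * a ⊑ c * b
  *-monoˡ {a} {b} {c} 0⊑c a⊑b =
    subst₂ _⊑_ (+-identityˡ (c * a)) split-cb (⊑-+ (*-nonneg 0⊑c 0⊑b-a) ⊑-refl)
    where
      0⊑b-a : 0# ⊑ b + - a
      0⊑b-a = subst (_⊑ b + - a) (-‿inverseʳ a) (+-mono-≤ (- a) a⊑b)
      split-cb : c * (b + - a) + c * a ≡ c * b
      split-cb = begin
        c * (b + - a) + c * a     ≡⟨ sym (distribˡ c (b + - a) a) ⟩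
        c * ((b + - a) + a)       ≡⟨ cong (c *_) (+-assoc b (- a) a) ⟩
        c * (b + (- a + a))       ≡⟨ cong (λ t → c * (b + t)) (trans (+-comm (- a) a) (-‿inverseʳ a)) ⟩
        c * (b + 0#)              ≡⟨ cong (c *_) (+-identityʳ b) ⟩
        c * b                     ∎
        where open ≡-Reasoning

  pow-nonneg : ∀ {x} k → 0# ⊑ x → 0# ⊑ pow x k
  pow-nonneg zero    0⊑x = 0⊑1
  pow-nonneg (suc k) 0⊑x = *-nonneg 0⊑x (pow-nonneg k 0⊑x)

  monomial-nonneg : ∀ {n} {x : Vec Carrier n} → VecAll.All (0# ⊑_) x →
                    ∀ a → 0# ⊑ mon a x
  monomial-nonneg []          []       = 0⊑1
  monomial-nonneg (0⊑x ∷ 0⊑xs) (k ∷ as) =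
    *-nonneg (pow-nonneg k 0⊑x) (monomial-nonneg 0⊑xs as)

  pow-+ : ∀ x a b → pow x (a ℕ.+ b) ≡ pow x a * pow x b
  pow-+ x zero    b = sym (*-identityˡ _)
  pow-+ x (suc a) b = trans (cong (x *_) (pow-+ x a b)) (sym (*-assoc _ _ _))

  monomial-+ : ∀ {n} (a b : Vec ℕ n) x → mon (zipWith ℕ._+_ a b) x ≡ mon a x * mon b x
  monomial-+ []       []       []       = sym (*-identityˡ 1#)
  monomial-+ (a ∷ as) (b ∷ bs) (x ∷ xs) =
    trans (cong₂ _*_ (pow-+ x a b) (monomial-+ as bs xs)) (*-interchange _ _ _ _)

  eval-++ : ∀ {n} (p q : Poly F n) x → ev (p ++ q) x ≡ ev p x + ev q x
  eval-++ []            q x = sym (+-identityˡ _)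
  eval-++ ((c , b) ∷ p) q x =
    trans (cong (c * mon b x +_) (eval-++ p q x)) (sym (+-assoc _ _ _))

  eval-scale : ∀ {n} μ (p : Poly F n) x → ev (scale F μ p) x ≡ μ * ev p x
  eval-scale μ []            x = sym (zeroʳ μ)
  eval-scale μ ((c , b) ∷ p) x =
    trans (cong₂ _+_ (*-assoc μ c (mon b x)) (eval-scale μ p x)) (sym (distribˡ _ _ _))

  eval-term-⊗ : ∀ {n} (s : Term F n) (q : Poly F n) x →
    ev (map (λ t → proj₁ s * proj₁ t , zipWith ℕ._+_ (proj₂ s) (proj₂ t)) q) x
      ≡ (proj₁ s * mon (proj₂ s) x) * ev q x
  eval-term-⊗ s       []            x = sym (zeroʳ _)
  eval-term-⊗ (c , b) ((d , e) ∷ q) x =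
    trans (cong₂ _+_ (trans (cong ((c * d) *_) (monomial-+ b e x)) (*-interchange _ _ _ _))
                     (eval-term-⊗ (c , b) q x))
          (sym (distribˡ _ _ _))

  eval-⊗ : ∀ {n} (p q : Poly F n) x → ev (_⊗_ F p q) x ≡ ev p x * ev q x
  eval-⊗ []      q x = sym (zeroˡ _)
  eval-⊗ (s ∷ p) q x =
    trans (eval-++ (map _ q) _ x)
      (trans (cong₂ _+_ (eval-term-⊗ s q x) (eval-⊗ p q x)) (sym (distribʳ _ _ _)))

  -- We show that a polynomial with only zero
  -- coefficients evaluates to 0, by removing all terms with a given
  -- exponent and recursing on the (shorter) remainder.

  coeff-++ : ∀ {n} (p q : Poly F n) a → coeff F (p ++ q) a ≡ coeff F p a + coeff F q a
  coeff-++ []            q a = sym (+-identityˡ _)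
  coeff-++ ((c , b) ∷ p) q a with VecP.≡-dec ℕ._≟_ b a
  ... | yes _ = trans (cong (c +_) (coeff-++ p q a)) (sym (+-assoc _ _ _))
  ... | no  _ = coeff-++ p q a

  coeff-scale : ∀ {n} μ (p : Poly F n) a → coeff F (scale F μ p) a ≡ μ * coeff F p a
  coeff-scale μ []            a = sym (zeroʳ μ)
  coeff-scale μ ((c , b) ∷ p) a with VecP.≡-dec ℕ._≟_ b a
  ... | yes _ = trans (cong (μ * c +_) (coeff-scale μ p a)) (sym (distribˡ _ _ _))
  ... | no  _ = coeff-scale μ p a

  without : ∀ {n} → Vec ℕ n → Poly F n → Poly F n
  without b []            = []
  without b ((c , e) ∷ p) with VecP.≡-dec ℕ._≟_ e b
  ... | yes _ = without b p
  ... | no  _ = (c , e) ∷ without b p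

  eval-without : ∀ {n} (b : Vec ℕ n) (p : Poly F n) x →
                 ev p x ≡ coeff F p b * mon b x + ev (without b p) x
  eval-without b [] x = sym (trans (cong (_+ 0#) (zeroˡ _)) (+-identityˡ 0#))
  eval-without b ((c , e) ∷ p) x with VecP.≡-dec ℕ._≟_ e b
  ... | yes refl = begin
      c * mon e x + ev p x
        ≡⟨ cong (c * mon e x +_) (eval-without e p x) ⟩
      c * mon e x + (coeff F p e * mon e x + ev (without e p) x)
        ≡⟨ sym (+-assoc _ _ _) ⟩
      (c * mon e x + coeff F p e * mon e x) + ev (without e p) x
        ≡⟨ cong (_+ ev (without e p) x) (sym (distribʳ _ _ _)) ⟩
      (c + coeff F p e) * mon e x + ev (without e p) x ∎
    where open ≡-Reasoning
  ... | no _ = begin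
      c * mon e x + ev p x
        ≡⟨ cong (c * mon e x +_) (eval-without b p x) ⟩
      c * mon e x + (coeff F p b * mon b x + ev (without b p) x)
        ≡⟨ sym (+-assoc _ _ _) ⟩
      (c * mon e x + coeff F p b * mon b x) + ev (without b p) x
        ≡⟨ cong (_+ ev (without b p) x) (+-comm _ _) ⟩
      (coeff F p b * mon b x + c * mon e x) + ev (without b p) x
        ≡⟨ +-assoc _ _ _ ⟩
      coeff F p b * mon b x + (c * mon e x + ev (without b p) x) ∎
    where open ≡-Reasoning

  coeff-without-same : ∀ {n} (b : Vec ℕ n) (p : Poly F n) → coeff F (without b p) b ≡ 0#
  coeff-without-same b []            = refl
  coeff-without-same b ((c , e) ∷ p) with VecP.≡-dec ℕ._≟_ e b
  ... | yes _  = coeff-without-same b p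
  ... | no e≢b with VecP.≡-dec ℕ._≟_ e b
  ...   | yes e≡b = contradiction e≡b e≢b
  ...   | no  _   = coeff-without-same b p

  coeff-without-other : ∀ {n} (b a : Vec ℕ n) (p : Poly F n) → ¬ b ≡ a →
                        coeff F (without b p) a ≡ coeff F p a
  coeff-without-other b a []            b≢a = refl
  coeff-without-other b a ((c , e) ∷ p) b≢a with VecP.≡-dec ℕ._≟_ e b
  ... | yes e≡b with VecP.≡-dec ℕ._≟_ e a
  ...   | yes e≡a = contradiction (trans (sym e≡b) e≡a) b≢a
  ...   | no  _   = coeff-without-other b a p b≢a
  coeff-without-other b a ((c , e) ∷ p) b≢a | no _ with VecP.≡-dec ℕ._≟_ e a
  ...   | yes _ = cong (c +_) (coeff-without-other b a p b≢a)
  ...   | no  _ = coeff-without-other b a p b≢a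

  length-without : ∀ {n} (b : Vec ℕ n) (p : Poly F n) → length (without b p) ≤ length p
  length-without b []            = z≤n
  length-without b ((c , e) ∷ p) with VecP.≡-dec ℕ._≟_ e b
  ... | yes _ = ℕP.m≤n⇒m≤1+n (length-without b p)
  ... | no  _ = s≤s (length-without b p)

  length-without-head : ∀ {n} (b : Vec ℕ n) c (p : Poly F n) →
                        length (without b ((c , b) ∷ p)) ≤ length p
  length-without-head b c p with VecP.≡-dec ℕ._≟_ b b
  ... | yes _   = length-without b p
  ... | no  b≢b = contradiction refl b≢b

  eval-vanishing : ∀ {n} k (r : Poly F n) → length r ≤ k →
                   (∀ a → coeff F r a ≡ 0#) → ∀ x → ev r x ≡ 0#
  eval-vanishing k       []            _         _      x = refl
  eval-vanishing (suc k) ((c , b) ∷ r) (s≤s len) vanish x = begin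
    ev ((c , b) ∷ r) x                             ≡⟨ eval-without b ((c , b) ∷ r) x ⟩
    coeff F ((c , b) ∷ r) b * mon b x + ev r′ x    ≡⟨ cong₂ _+_ (cong (_* mon b x) (vanish b)) r′-vanishes ⟩
    0# * mon b x + 0#                              ≡⟨ trans (+-identityʳ _) (zeroˡ _) ⟩
    0#                                             ∎
    where
      open ≡-Reasoning
      r′ : Poly F _
      r′ = without b ((c , b) ∷ r)
      r′-coeffs : ∀ a → coeff F r′ a ≡ 0#
      r′-coeffs a with VecP.≡-dec ℕ._≟_ b a
      ... | yes refl = coeff-without-same b ((c , b) ∷ r)
      ... | no  b≢a  = trans (coeff-without-other b a ((c , b) ∷ r) b≢a) (vanish a)
      r′-vanishes : ev r′ x ≡ 0#
      r′-vanishes = eval-vanishing k r′ (ℕP.≤-trans (length-without-head b c r) len) r′-coeffs x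

  -- Equal polynomials have equal values: p - q has vanishing coefficients.
  eval-≐ : ∀ {n} (p q : Poly F n) → _≐_ F p q → ∀ x → ev p x ≡ ev q x
  eval-≐ p q p≐q x = x∙y⁻¹≈ε⇒x≈y (ev p x) (ev q x) (begin
    ev p x + - ev q x          ≡⟨ cong (ev p x +_) (sym (-1*x≈-x (ev q x))) ⟩
    ev p x + - 1# * ev q x     ≡⟨ sym (trans (eval-++ p d x) (cong (ev p x +_) (eval-scale (- 1#) q x))) ⟩
    ev (p ++ d) x              ≡⟨ eval-vanishing _ (p ++ d) ℕP.≤-refl difference-vanishes x ⟩
    0#                         ∎)
    where
      open ≡-Reasoning
      d : Poly F _
      d = scale F (- 1#) q
      difference-vanishes : ∀ a → coeff F (p ++ d) a ≡ 0#
      difference-vanishes a = begin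
        coeff F (p ++ d) a                  ≡⟨ coeff-++ p d a ⟩
        coeff F p a + coeff F d a           ≡⟨ cong₂ _+_ (p≐q a) (coeff-scale (- 1#) q a) ⟩
        coeff F q a + - 1# * coeff F q a    ≡⟨ cong (coeff F q a +_) (-1*x≈-x _) ⟩
        coeff F q a + - coeff F q a         ≡⟨ -‿inverseʳ _ ⟩
        0#                                  ∎

  ∑-cong : ∀ {k} {f g : Fin k → Carrier} → (∀ i → f i ≡ g i) → ∑ F f ≡ ∑ F g
  ∑-cong {zero}  f≡g = refl
  ∑-cong {suc k} f≡g = cong₂ _+_ (f≡g zero) (∑-cong (λ i → f≡g (suc i)))

  ∏-cong : ∀ {k} {f g : Fin k → Carrier} → (∀ i → f i ≡ g i) → ∏ F f ≡ ∏ F g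
  ∏-cong {zero}  f≡g = refl
  ∏-cong {suc k} f≡g = cong₂ _*_ (f≡g zero) (∏-cong (λ i → f≡g (suc i)))

  ∑-zero : ∀ {k} (f : Fin k → Carrier) → (∀ i → f i ≡ 0#) → ∑ F f ≡ 0#
  ∑-zero {zero}  f f≡0 = refl
  ∑-zero {suc k} f f≡0 =
    trans (cong₂ _+_ (f≡0 zero) (∑-zero (λ i → f (suc i)) (λ i → f≡0 (suc i)))) (+-identityˡ 0#)

  ∏-one : ∀ k → ∏ F {k} (λ _ → 1#) ≡ 1#
  ∏-one zero    = refl
  ∏-one (suc k) = trans (*-identityˡ _) (∏-one k)

  ∏-indicator : ∀ {k} (x : Vec Carrier k) (j : Fin k) →
    ∏ F (λ i → pow (lookup x i) (if does (i ≟ j) then 1 else 0)) ≡ lookup x j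
  ∏-indicator {suc k} (x ∷ xs) zero    = trans (cong₂ _*_ (*-identityʳ x) (∏-one k)) (*-identityʳ x)
  ∏-indicator {suc k} (x ∷ xs) (suc j) = trans (*-identityˡ _) (∏-indicator xs j)

  lookup-unitVec : ∀ {n} (j i : Fin n) → lookup (unitVec F j) i ≡ (if does (i ≟ j) then 1 else 0)
  lookup-unitVec j i rewrite (lookup (unitVec F j) i ≡ _ ∋ VecP.lookup∘tabulate _ i) with i ≟ j
  ... | yes _ = refl
  ... | no  _ = refl

  monomial-unitVec : ∀ {n} (j : Fin n) x → mon (unitVec F j) x ≡ lookup x j
  monomial-unitVec j x =
    trans (∏-cong (λ i → cong (pow (lookup x i)) (lookup-unitVec j i))) (∏-indicator x j)

  monomial-const : ∀ {k} (x : Vec Carrier k) → mon (replicate k 0) x ≡ 1#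
  monomial-const []       = refl
  monomial-const (x ∷ xs) = trans (*-identityˡ _) (monomial-const xs)

  eval-tabulate : ∀ {k n} (c : Fin k → Carrier) (a : Fin k → Vec ℕ n) x →
    ev (List.tabulate (λ j → c j , a j)) x ≡ ∑ F (λ j → c j * mon (a j) x)
  eval-tabulate {zero}  c a x = refl
  eval-tabulate {suc k} c a x =
    cong (c zero * mon (a zero) x +_) (eval-tabulate (λ j → c (suc j)) (λ j → a (suc j)) x)

  linearForm : (n : ℕ) → Poly F n
  linearForm n = (1# , replicate n 0) ∷ List.tabulate (λ j → (- 1#) , unitVec F j)

  eval-linearForm : ∀ {n} (x : Vec Carrier n) →
                    ev (linearForm n) x ≡ 1# + ∑ F (λ j → - 1# * lookup x j)
  eval-linearForm x =
    cong₂ _+_ (trans (cong (1# *_) (monomial-const x)) (*-identityˡ 1#))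
      (trans (eval-tabulate (λ _ → - 1#) (unitVec F) x)
             (∑-cong (λ j → cong (- 1# *_) (monomial-unitVec j x))))

  eval-N : ∀ {n} (x : Vec Carrier n) → ev (N F n) x ≡ ev (linearForm n) x * ev (linearForm n) x
  eval-N {n} x = eval-⊗ (linearForm n) (linearForm n) x

  ∑-neg-zeros : ∀ k → ∑ F (λ j → - 1# * lookup (replicate k 0#) j) ≡ 0#
  ∑-neg-zeros k = ∑-zero {k} _ (λ j → trans (cong (- 1# *_) (VecP.lookup-replicate j 0#)) (zeroʳ _))

  monomial-vanishes : ∀ {n} (x : Vec Carrier n) (a : Vec ℕ n) (i : Fin n) {k} →
                      lookup x i ≡ 0# → lookup a i ≡ suc k → mon a x ≡ 0#
  monomial-vanishes (_ ∷ xs) (_ ∷ as) zero    refl refl =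
    trans (cong (_* mon as xs) (zeroˡ _)) (zeroˡ _)
  monomial-vanishes (x ∷ xs) (a ∷ as) (suc i) xᵢ≡0 aᵢ≡1+k =
    trans (cong (pow x a *_) (monomial-vanishes xs as i xᵢ≡0 aᵢ≡1+k)) (zeroʳ _)

  eval-mono : ∀ {n} {x y : Vec Carrier n} (p : Poly F n) → All (λ t → 0# ⊑ proj₁ t) p →
              (∀ a → mon a x ⊑ mon a y) → ev p x ⊑ ev p y
  eval-mono []      []         dom = ⊑-refl
  eval-mono {x = x} {y} ((c , a) ∷ p) (0⊑c ∷ ps) dom =
    ⊑-+ (*-monoˡ 0⊑c (dom a)) (eval-mono {x = x} {y} p ps dom)

  circuit-mono : ∀ {n} {x y : Vec Carrier n} (C : Circuit F n) →
                 (∀ a → mon a x ⊑ mon a y) → mon (Circuit.β C) x ≡ mon (Circuit.β C) y →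
                 ev (circuitPoly F C) x ⊑ ev (circuitPoly F C) y
  circuit-mono {x = x} {y} C dom β-agrees =
    ⊑-+ (subst (fβ * mon β x ⊑_) (cong (fβ *_) β-agrees) ⊑-refl)
        (eval-mono {x = x} {y} (List.tabulate (λ j → fα j , α j))
                   (tabulate⁺ {f = λ j → fα j , α j} (λ j → proj₁ (fα>0 j))) dom)
    where open Circuit C

  ThreePointIneq : ∀ {n} → Vec Carrier n → Vec Carrier n → Vec Carrier n → Poly F n → Set
  ThreePointIneq x y w p = ev p x ⊑ ev p y + ev p w

  -- It is a linear condition, hence stable under nonnegative scaling and sums
  -- and so under passing from nonnegative circuit polynomials to SONC.
  module _ {n} (x y w : Vec Carrier n) where

    threePoint-scale : ∀ {μ} (p : Poly F n) → 0# ⊑ μ →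
                       ThreePointIneq x y w p → ThreePointIneq x y w (scale F μ p)
    threePoint-scale {μ} p 0⊑μ ineq =
      subst₂ _⊑_ (sym (eval-scale μ p x))
        (trans (distribˡ μ _ _) (sym (cong₂ _+_ (eval-scale μ p y) (eval-scale μ p w))))
        (*-monoˡ 0⊑μ ineq)

    threePoint-++ : ∀ (p q : Poly F n) → ThreePointIneq x y w p → ThreePointIneq x y w q →
                    ThreePointIneq x y w (p ++ q)
    threePoint-++ p q ineq-p ineq-q =
      subst₂ _⊑_ (sym (eval-++ p q x))
        (sym (trans (cong₂ _+_ (eval-++ p q y) (eval-++ p q w)) (+-interchange _ _ _ _)))
        (⊑-+ ineq-p ineq-q)

    threePoint-SONC : (∀ C → Nonneg F (circuitPoly F C) → ThreePointIneq x y w (circuitPoly F C)) →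
                      ∀ f → SONC F f → ThreePointIneq x y w f
    threePoint-SONC circuit-ineq f (ps , nonneg , f≐sum) =
      subst₂ _⊑_ (sym (eval-≐ f (combination ps) f≐sum x))
        (sym (cong₂ _+_ (eval-≐ f (combination ps) f≐sum y) (eval-≐ f (combination ps) f≐sum w)))
        (combination-ineq ps nonneg)
      where
        combination : List (Carrier × Circuit F n) → Poly F n
        combination ps = sumPolys F (map (λ t → scale F (proj₁ t) (circuitPoly F (proj₂ t))) ps)

        combination-ineq : (ps : List (Carrier × Circuit F n)) →
          All (λ t → (0# ⊑ proj₁ t) × Nonneg F (circuitPoly F (proj₂ t))) ps →
          ThreePointIneq x y w (combination ps)
        combination-ineq []             []                    = subst (0# ⊑_) (sym (+-identityˡ 0#)) ⊑-refl
        combination-ineq ((μ , C) ∷ ps) ((0⊑μ , C≥0) ∷ rest) =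
          threePoint-++ (scale F μ (circuitPoly F C)) (combination ps)
            (threePoint-scale (circuitPoly F C) 0⊑μ (circuit-ineq C C≥0))
            (combination-ineq ps rest)

  module ThreePoints (m : ℕ) where

    n : ℕ
    n = suc (suc m)

    z e₁ e₂ : Vec Carrier n
    z  = replicate n 0#
    e₁ = 1# ∷ replicate (suc m) 0#
    e₂ = 0# ∷ 1# ∷ replicate m 0#

    zeros-nonneg : ∀ k → VecAll.All (0# ⊑_) (replicate k 0#)
    zeros-nonneg zero    = []
    zeros-nonneg (suc k) = ⊑-refl ∷ zeros-nonneg k

    e₁-nonneg : VecAll.All (0# ⊑_) e₁
    e₁-nonneg = 0⊑1 ∷ zeros-nonneg (suc m)

    e₂-nonneg : VecAll.All (0# ⊑_) e₂
    e₂-nonneg = ⊑-refl ∷ 0⊑1 ∷ zeros-nonneg m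

    -- z^a ⊑ e₁^a: equality if a₀ = 0, and z^a = 0 otherwise; likewise for e₂.
    z⊑e₁ : ∀ a → mon a z ⊑ mon a e₁
    z⊑e₁ (zero  ∷ as) = ⊑-refl
    z⊑e₁ (suc k ∷ as) =
      subst (_⊑ mon (suc k ∷ as) e₁) (sym (monomial-vanishes z (suc k ∷ as) zero refl refl))
        (monomial-nonneg e₁-nonneg (suc k ∷ as))

    z⊑e₂ : ∀ a → mon a z ⊑ mon a e₂
    z⊑e₂ (a₀ ∷ zero  ∷ as) = ⊑-refl
    z⊑e₂ (a₀ ∷ suc k ∷ as) =
      subst (_⊑ mon (a₀ ∷ suc k ∷ as) e₂) (sym (monomial-vanishes z (a₀ ∷ suc k ∷ as) (suc zero) refl refl))
        (monomial-nonneg e₂-nonneg (a₀ ∷ suc k ∷ as))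

    -- Every monomial takes the same value at z as at e₁ or at e₂
    -- (at e₂ both vanish when a₀ > 0).
    z-agrees : ∀ a → (mon a z ≡ mon a e₁) ⊎ (mon a z ≡ mon a e₂)
    z-agrees (zero  ∷ as) = inj₁ refl
    z-agrees (suc k ∷ as) =
      inj₂ (trans (monomial-vanishes z (suc k ∷ as) zero refl refl)
                 (sym (monomial-vanishes e₂ (suc k ∷ as) zero refl refl)))

    circuit-threePoint : ∀ C → Nonneg F (circuitPoly F C) → ThreePointIneq z e₁ e₂ (circuitPoly F C)
    circuit-threePoint C P≥0 with z-agrees (Circuit.β C)
    ... | inj₁ β-agrees = ⊑-trans (circuit-mono {x = z} {e₁} C z⊑e₁ β-agrees) (⊑-+ʳ (P≥0 e₂))
    ... | inj₂ β-agrees = ⊑-trans (circuit-mono {x = z} {e₂} C z⊑e₂ β-agrees) (⊑-+ˡ (P≥0 e₁))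

    L-z : ev (linearForm n) z ≡ 1#
    L-z = trans (eval-linearForm z) (trans (cong (1# +_) (∑-neg-zeros n)) (+-identityʳ 1#))

    1-1≡0 : 1# + (- 1# * 1# + 0#) ≡ 0#
    1-1≡0 = trans (cong (1# +_) (trans (+-identityʳ _) (*-identityʳ _))) (-‿inverseʳ 1#)

    L-e₁ : ev (linearForm n) e₁ ≡ 0#
    L-e₁ = trans (eval-linearForm e₁) (trans (cong (λ t → 1# + (- 1# * 1# + t)) (∑-neg-zeros (suc m))) 1-1≡0)

    L-e₂ : ev (linearForm n) e₂ ≡ 0#
    L-e₂ = trans (eval-linearForm e₂)
      (trans (cong₂ (λ s t → 1# + (s + (- 1# * 1# + t))) (zeroʳ _) (∑-neg-zeros m))
             (trans (cong (1# +_) (+-identityˡ _)) 1-1≡0))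

    square-zero : ∀ {a} → a ≡ 0# → a * a ≡ 0#
    square-zero refl = zeroˡ 0#

    N-not-SONC : ¬ SONC F (N F n)
    N-not-SONC sonc = 1⋢0 (subst₂ _⊑_ N-z N-e₁+N-e₂ ineq)
      where
        ineq : ThreePointIneq z e₁ e₂ (N F n)
        ineq = threePoint-SONC z e₁ e₂ circuit-threePoint (N F n) sonc
        N-z : ev (N F n) z ≡ 1#
        N-z = trans (eval-N z) (trans (cong₂ _*_ L-z L-z) (*-identityˡ 1#))
        N-e₁+N-e₂ : ev (N F n) e₁ + ev (N F n) e₂ ≡ 0#
        N-e₁+N-e₂ =
          trans (cong₂ _+_ (trans (eval-N e₁) (square-zero L-e₁)) (trans (eval-N e₂) (square-zero L-e₂)))
                (+-identityˡ 0#)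

lemma3p2 : (F : CompleteOrderedField) → (n : ℕ) → 2 ≤ n → ¬ SONC F (N F n)
lemma3p2 F (suc (suc m)) (s≤s (s≤s _)) = ThreePoints.N-not-SONC F m
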